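{- A finite binary word is a factor of $\mathbf{b}$ if and only if it does not contain $00$ (two consecutive $0$'s) as a factor.
   Context: Define finite binary words $B_i$ by $B_1 = 101$ and $B_{i+1} = B_i C_i$ for $i \geq 1$, where $C_i$ is the word obtained from $B_i$ by removing its first $i$ symbols. Since each $B_i$ is a prefix of $B_{i+1}$, there is a unique infinite binary word $\mathbf{b}$ of which every $B_i$ is a prefix. A factor is a contiguous subword. -}

module Defs where

open import Data.Bool using (Bool; true; false)
open import Data.Nat using (ℕ; zero; suc; _+_)
open import Data.List using (List; []; _∷_; _++_; drop; applyUpTo; length)
open import Relation.Binary.PropositionalEquality using (_≡_)
open import Data.List.Relation.Binary.Infix.Heterogeneous using (Infix)
open import Data.Product using (∃)

-- Binary letters: false = 0, true = 1.
Word : Set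
Word = List Bool

-- B n  is the paper's  B_{n+1}  (0-based index).
-- B_1 = 101 ;  B_{i+1} = B_i C_i  where C_i = B_i with its first i symbols removed.
B : ℕ → Word
B zero    = true ∷ false ∷ true ∷ []
B (suc n) = B n ++ drop (suc n) (B n)

-- n-th symbol of a finite word (0-based); the default is never used below
-- because |B_{n+1}| ≥ n + 3 > n.
nth : Word → ℕ → Bool
nth []       _       = false
nth (x ∷ xs) zero    = x
nth (x ∷ xs) (suc n) = nth xs n

-- The infinite word b : position n (0-based) is read off from the prefix B_{n+1}.
b : ℕ → Bool
b n = nth (B n) n

FactorOfB : Word → Set
FactorOfB w = ∃ λ i → applyUpTo (λ j → b (i + j)) (length w) ≡ w

FactorOf : Word → Word → Set
FactorOf w v = Infix _≡_ w v

zerozero : Word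
zerozero = false ∷ false ∷ []

{-# OPTIONS --safe #-}

-- Write B_{n+1} = P C with |P| = n + 1, so that C is the paper's C_{n+1} and B_{n+2} = P C C;
-- by induction C ends in 01 and |C| ≥ n + 2.
--
-- No B_n contains 00, since B_{n+2} is B_{n+1}, which ends in 1, followed by the suffix C of
-- B_{n+1}; every B_n is a prefix of b, so b contains no 00 either.
--
-- Conversely, call w recurrent if it occurs in b at arbitrarily large positions. An occurrence
-- of w at position n + 1 with |w| ≤ n is a prefix of C, which in B_{n+2} = P C C occurs again
-- right after the final 01 of P C; so 01w is recurrent whenever w is. Recurrent words are also
-- closed under taking prefixes and suffixes, and every 00-free word is reached from the empty
-- word by these operations, peeling off a leading 1 or 01.
module Submission where

open import Defs
open import Data.Product using (_×_; ∃; _,_)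
open import Relation.Nullary using (¬_)

open import Level using (Level)
open import Data.Bool using (Bool; true; false; _∨_; T)
open import Data.Unit using (tt)
open import Data.Empty using (⊥-elim)
open import Data.Nat using (ℕ; zero; suc; _+_; _⊓_; _≤_; _<_; _≤′_; ≤′-refl; ≤′-step; z≤n; s≤s)
open import Data.Nat.Properties
  using (≤-refl; ≤-trans; ≤-total; ≤⇒≤′; m≤m+n; m≤n+m; n≤1+n; n<1+n; +-suc; +-assoc; +-comm; m≤n⇒m⊓n≡m; module ≤-Reasoning)
open import Data.Sum using (inj₁; inj₂)
open import Data.Maybe using (just; nothing)
open import Data.Maybe.Relation.Binary.Connected using (Connected; just; just-nothing)
open import Data.List using (List; []; _∷_; _++_; [_]; take; drop; applyUpTo; length; last; head)
open import Data.List.Properties using (length-++; length-++-≤ˡ; length-++-≤ʳ; ++-assoc; ++-identityʳ; ∷ʳ-++; length-take)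
open import Data.List.Relation.Unary.Linked using (Linked; []; [-]; _∷_; tail)
open import Data.List.Relation.Unary.Linked.Properties using (++⁺; applyUpTo⁺₂)
open import Data.List.Relation.Binary.Infix.Heterogeneous using (here; there)
open import Data.List.Relation.Binary.Prefix.Heterogeneous using ([]; _∷_)
open import Function using (_∘_)
open import Relation.Binary.Core using (Rel)
open import Relation.Binary.PropositionalEquality
  using (_≡_; refl; sym; trans; cong; cong₂; subst; module ≡-Reasoning)

private
  variable
    a r : Level
    A : Set a

drop-length-++ : ∀ (xs ys : List A) → drop (length xs) (xs ++ ys) ≡ ys
drop-length-++ []       ys = refl
drop-length-++ (x ∷ xs) ys = drop-length-++ xs ys

last-++-∷ : ∀ (xs : List A) y ys → last (xs ++ y ∷ ys) ≡ last (y ∷ ys)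
last-++-∷ []           y ys = refl
last-++-∷ (x ∷ [])     y ys = refl
last-++-∷ (x ∷ x′ ∷ xs) y ys = last-++-∷ (x′ ∷ xs) y ys

applyUpTo-cong : ∀ {f g : ℕ → A} n → (∀ {j} → j < n → f j ≡ g j) → applyUpTo f n ≡ applyUpTo g n
applyUpTo-cong zero    f≡g = refl
applyUpTo-cong (suc n) f≡g = cong₂ _∷_ (f≡g (s≤s z≤n)) (applyUpTo-cong n (f≡g ∘ s≤s))

take-applyUpTo : ∀ (f : ℕ → A) m n → take m (applyUpTo f n) ≡ applyUpTo f (m ⊓ n)
take-applyUpTo f zero    n       = refl
take-applyUpTo f (suc m) zero    = refl
take-applyUpTo f (suc m) (suc n) = cong (f 0 ∷_) (take-applyUpTo (f ∘ suc) m n)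

drop-applyUpTo : ∀ (f : ℕ → A) m n → drop m (applyUpTo f (m + n)) ≡ applyUpTo (λ j → f (m + j)) n
drop-applyUpTo f zero    n = refl
drop-applyUpTo f (suc m) n = drop-applyUpTo (f ∘ suc) m n

module _ {R : Rel A r} where

  drop⁺ : ∀ k {xs} → Linked R xs → Linked R (drop k xs)
  drop⁺ zero             xs↝ = xs↝
  drop⁺ (suc k) {[]}     xs↝ = []
  drop⁺ (suc k) {x ∷ xs} xs↝ = drop⁺ k (tail xs↝)

applyUpTo-nth : ∀ xs → applyUpTo (nth xs) (length xs) ≡ xs
applyUpTo-nth []       = refl
applyUpTo-nth (x ∷ xs) = cong (x ∷_) (applyUpTo-nth xs)

nth-++ˡ : ∀ xs ys {k} → k < length xs → nth (xs ++ ys) k ≡ nth xs k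
nth-++ˡ (x ∷ xs) ys {zero}  _        = refl
nth-++ˡ (x ∷ xs) ys {suc k} (s≤s k<) = nth-++ˡ xs ys k<

linked-nth : ∀ {R : Rel Bool r} {xs} → Linked R xs → ∀ {k} → suc k < length xs → R (nth xs k) (nth xs (suc k))
linked-nth (Rxy ∷ _)   {zero}  _        = Rxy
linked-nth (_   ∷ xs↝) {suc k} (s≤s k<) = linked-nth xs↝ k<
linked-nth [-] (s≤s ())

module _ (s : ℕ → A) where

  window : ℕ → ℕ → List A
  window i L = applyUpTo (λ j → s (i + j)) L

  OccursAt : List A → ℕ → Set _
  OccursAt w i = window i (length w) ≡ w

  occursAt-++ʳ : ∀ xs {ys i} → OccursAt (xs ++ ys) i → OccursAt ys (i + length xs)
  occursAt-++ʳ xs {ys} {i} occ = begin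
    window (i + length xs) (length ys)
      ≡⟨ applyUpTo-cong (length ys) (λ {j} _ → cong s (+-assoc i (length xs) j)) ⟩
    applyUpTo (λ j → s (i + (length xs + j))) (length ys)
      ≡⟨ sym (drop-applyUpTo (λ j → s (i + j)) (length xs) (length ys)) ⟩
    drop (length xs) (window i (length xs + length ys))
      ≡⟨ cong (drop (length xs) ∘ window i) (sym (length-++ xs)) ⟩
    drop (length xs) (window i (length (xs ++ ys)))
      ≡⟨ cong (drop (length xs)) occ ⟩
    drop (length xs) (xs ++ ys)
      ≡⟨ drop-length-++ xs ys ⟩
    ys ∎
    where open ≡-Reasoning

  occursAt-take : ∀ m {w i} → OccursAt w i → OccursAt (take m w) i
  occursAt-take m {w} {i} occ = begin
    window i (length (take m w))   ≡⟨ cong (window i) (length-take m w) ⟩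
    window i (m ⊓ length w)        ≡⟨ sym (take-applyUpTo _ m (length w)) ⟩
    take m (window i (length w))   ≡⟨ cong (take m) occ ⟩
    take m w                       ∎
    where open ≡-Reasoning

  occursAt-prefix : ∀ {v w i} → OccursAt v i → OccursAt w i → length v ≤ length w → take (length v) w ≡ v
  occursAt-prefix {v} {w} {i} v-occ w-occ |v|≤|w| = begin
    take (length v) w                          ≡⟨ cong (take (length v)) (sym w-occ) ⟩
    take (length v) (window i (length w))      ≡⟨ take-applyUpTo _ (length v) (length w) ⟩
    window i (length v ⊓ length w)             ≡⟨ cong (window i) (m≤n⇒m⊓n≡m |v|≤|w|) ⟩
    window i (length v)                        ≡⟨ v-occ ⟩
    v                                          ∎
    where open ≡-Reasoning

  occursAt-linked : ∀ {R : Rel A r} → (∀ k → R (s k) (s (suc k))) → ∀ {w i} → OccursAt w i → Linked R w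
  occursAt-linked {R = R} s↝ {w} {i} occ = subst (Linked R) occ (applyUpTo⁺₂ _ (length w) s↝-from-i)
    where
    s↝-from-i : ∀ j → R (s (i + j)) (s (i + suc j))
    s↝-from-i j = subst (R (s (i + j)) ∘ s) (sym (+-suc i j)) (s↝ (i + j))

B-suc : ∀ {n} P C → B n ≡ P ++ C → length P ≡ suc n → B (suc n) ≡ (P ++ C) ++ C
B-suc {n} P C B≡ |P|≡ = begin
  B n ++ drop (suc n) (B n)               ≡⟨ cong (λ xs → xs ++ drop (suc n) xs) B≡ ⟩
  (P ++ C) ++ drop (suc n) (P ++ C)       ≡⟨ cong (λ k → (P ++ C) ++ drop k (P ++ C)) (sym |P|≡) ⟩
  (P ++ C) ++ drop (length P) (P ++ C)    ≡⟨ cong ((P ++ C) ++_) (drop-length-++ P C) ⟩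
  (P ++ C) ++ C                           ∎
  where open ≡-Reasoning

record Split (n : ℕ) : Set where
  field
    P C C₀   : Word
    B≡P++C   : B n ≡ P ++ C
    length-P : length P ≡ suc n
    length-C : 2 + n ≤ length C
    C≡C₀++01 : C ≡ C₀ ++ false ∷ true ∷ []

split : ∀ n → Split n
split zero = record
  { P = [ true ] ; C = false ∷ true ∷ [] ; C₀ = []
  ; B≡P++C = refl ; length-P = refl ; length-C = ≤-refl ; C≡C₀++01 = refl }
split (suc n) with split n
... | record { P = P ; C = c ∷ c′ ∷ Cs ; C₀ = C₀ ; B≡P++C = B≡ ; length-P = |P|≡
             ; length-C = s≤s (s≤s n≤|Cs|) ; C≡C₀++01 = C≡ } = record
  { P        = P ++ [ c ]
  ; C        = c′ ∷ Cs ++ c ∷ c′ ∷ Cs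
  ; C₀       = c′ ∷ Cs ++ C₀
  ; B≡P++C   = trans (B-suc P (c ∷ c′ ∷ Cs) B≡ |P|≡) (trans (++-assoc P _ _) (sym (∷ʳ-++ P c _)))
  ; length-P = trans (length-++ P) (trans (cong (_+ 1) |P|≡) (+-comm (suc n) 1))
  ; length-C = s≤s (≤-trans (s≤s (s≤s n≤|Cs|)) (length-++-≤ʳ (c ∷ c′ ∷ Cs) {Cs}))
  ; C≡C₀++01 = cong (c′ ∷_) (trans (cong (Cs ++_) C≡) (sym (++-assoc Cs C₀ _))) }

<-length-B : ∀ n → n < length (B n)
<-length-B n = begin-strict
  n                  <⟨ n<1+n n ⟩
  suc n              ≡⟨ sym length-P ⟩
  length P           ≤⟨ length-++-≤ˡ P ⟩
  length (P ++ C)    ≡⟨ cong length (sym B≡P++C) ⟩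
  length (B n)       ∎
  where open Split (split n)
        open ≤-Reasoning

last-B : ∀ n → last (B n) ≡ just true
last-B n = begin
  last (B n)                              ≡⟨ cong last B≡P++C ⟩
  last (P ++ C)                           ≡⟨ cong (last ∘ (P ++_)) C≡C₀++01 ⟩
  last (P ++ C₀ ++ false ∷ true ∷ [])      ≡⟨ cong last (sym (++-assoc P C₀ _)) ⟩
  last ((P ++ C₀) ++ false ∷ true ∷ [])    ≡⟨ last-++-∷ (P ++ C₀) false _ ⟩
  just true                               ∎
  where open Split (split n)
        open ≡-Reasoning

B-prefix : ∀ {m n} → m ≤′ n → ∃ λ ys → B n ≡ B m ++ ys
B-prefix ≤′-refl = [] , sym (++-identityʳ _)
B-prefix {m} (≤′-step {n} m≤n) with B-prefix m≤n
... | ys , B≡ = ys ++ drop (suc n) (B n) , trans (cong (_++ drop (suc n) (B n)) B≡) (++-assoc (B m) ys _)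

b-nth-B : ∀ n {i} → i < length (B n) → b i ≡ nth (B n) i
b-nth-B n {i} i< with ≤-total i n
... | inj₁ i≤n with B-prefix (≤⇒≤′ i≤n)
...   | ys , B≡ = trans (sym (nth-++ˡ (B i) ys (<-length-B i))) (cong (λ xs → nth xs i) (sym B≡))
b-nth-B n {i} i< | inj₂ n≤i with B-prefix (≤⇒≤′ n≤i)
...   | ys , B≡ = trans (cong (λ xs → nth xs i) B≡) (nth-++ˡ (B n) ys i<)

b-begins-with-B : ∀ n → OccursAt b (B n) 0
b-begins-with-B n = trans (applyUpTo-cong (length (B n)) (b-nth-B n)) (applyUpTo-nth (B n))

occursAt-B-suffix : ∀ n xs {ys} → B n ≡ xs ++ ys → OccursAt b ys (length xs)
occursAt-B-suffix n xs B≡ = occursAt-++ʳ b xs {i = 0} (subst (λ v → OccursAt b v 0) B≡ (b-begins-with-B n))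

NotBothFalse : Bool → Bool → Set
NotBothFalse x y = T (x ∨ y)

linked⇒00-free : ∀ {w} → Linked NotBothFalse w → ¬ FactorOf zerozero w
linked⇒00-free []       (here ())
linked⇒00-free [-]      (here (_ ∷ ()))
linked⇒00-free (() ∷ _) (here (refl ∷ refl ∷ []))
linked⇒00-free w↝      (there 00∈w) = linked⇒00-free (tail w↝) 00∈w

true-connected : ∀ y → Connected NotBothFalse (just true) y
true-connected (just _) = just tt
true-connected nothing  = just-nothing

B-linked : ∀ n → Linked NotBothFalse (B n)
B-linked zero    = tt ∷ tt ∷ [-]
B-linked (suc n) = ++⁺ (B-linked n) B-C-connected (drop⁺ (suc n) (B-linked n))
  where
  B-C-connected : Connected NotBothFalse (last (B n)) (head (drop (suc n) (B n)))
  B-C-connected = subst (λ x → Connected NotBothFalse x (head (drop (suc n) (B n)))) (sym (last-B n)) (true-connected _)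

b-linked : ∀ k → NotBothFalse (b k) (b (suc k))
b-linked k = subst (λ x → NotBothFalse x (b (suc k))) (sym (b-nth-B (suc k) k<))
                   (linked-nth (B-linked (suc k)) (<-length-B (suc k)))
  where
  k< : k < length (B (suc k))
  k< = ≤-trans (n≤1+n _) (<-length-B (suc k))

Recurrent : Word → Set
Recurrent w = ∀ N → ∃ λ i → N ≤ i × OccursAt b w i

[]-recurrent : Recurrent []
[]-recurrent N = N , ≤-refl , refl

recurrent-take : ∀ m {w} → Recurrent w → Recurrent (take m w)
recurrent-take m w-rec N with w-rec N
... | i , N≤i , occ = i , N≤i , occursAt-take b m {i = i} occ

recurrent-tail : ∀ {x w} → Recurrent (x ∷ w) → Recurrent w
recurrent-tail {x} xw-rec N with xw-rec N
... | i , N≤i , occ = i + 1 , ≤-trans N≤i (m≤m+n i 1) , occursAt-++ʳ b [ x ] {i = i} occ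

recurrent-01∷ : ∀ {w} → Recurrent w → Recurrent (false ∷ true ∷ w)
recurrent-01∷ {w} w-rec N with w-rec (suc (N + length w))
... | zero  , ()                , _
... | suc n , s≤s N+|w|≤n , w-occ =
  length (P ++ C₀) , N≤|PC₀| , subst (λ v → OccursAt b (false ∷ true ∷ v) (length (P ++ C₀))) w-prefix-C 01w-occ
  where
  open Split (split n)

  N≤|PC₀| : N ≤ length (P ++ C₀)
  N≤|PC₀| = begin
    N                  ≤⟨ m≤m+n N _ ⟩
    N + length w       ≤⟨ N+|w|≤n ⟩
    n                  ≤⟨ n≤1+n n ⟩
    suc n              ≡⟨ sym length-P ⟩
    length P           ≤⟨ length-++-≤ˡ P ⟩
    length (P ++ C₀)   ∎
    where open ≤-Reasoning

  |w|≤|C| : length w ≤ length C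
  |w|≤|C| = begin
    length w           ≤⟨ m≤n+m _ N ⟩
    N + length w       ≤⟨ N+|w|≤n ⟩
    n                  ≤⟨ m≤n+m n 2 ⟩
    2 + n              ≤⟨ length-C ⟩
    length C           ∎
    where open ≤-Reasoning

  w-prefix-C : take (length w) C ≡ w
  w-prefix-C = occursAt-prefix b {i = suc n} w-occ
                 (subst (OccursAt b C) length-P (occursAt-B-suffix n P B≡P++C)) |w|≤|C|

  B′≡ : B (suc n) ≡ (P ++ C₀) ++ false ∷ true ∷ C
  B′≡ = begin
    B (suc n)                                ≡⟨ B-suc P C B≡P++C length-P ⟩
    (P ++ C) ++ C                            ≡⟨ cong (λ v → (P ++ v) ++ C) C≡C₀++01 ⟩
    (P ++ C₀ ++ false ∷ true ∷ []) ++ C      ≡⟨ ++-assoc P _ C ⟩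
    P ++ (C₀ ++ false ∷ true ∷ []) ++ C      ≡⟨ cong (P ++_) (++-assoc C₀ _ C) ⟩
    P ++ C₀ ++ false ∷ true ∷ C              ≡⟨ sym (++-assoc P C₀ _) ⟩
    (P ++ C₀) ++ false ∷ true ∷ C            ∎
    where open ≡-Reasoning

  01w-occ : OccursAt b (take (2 + length w) (false ∷ true ∷ C)) (length (P ++ C₀))
  01w-occ = occursAt-take b (2 + length w) {i = length (P ++ C₀)} (occursAt-B-suffix (suc n) (P ++ C₀) B′≡)

00-free⇒recurrent : ∀ w → ¬ FactorOf zerozero w → Recurrent w
00-free⇒recurrent []                  _    = []-recurrent
00-free⇒recurrent (true ∷ w)          w∌00 = recurrent-tail (recurrent-01∷ (00-free⇒recurrent w (w∌00 ∘ there)))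
00-free⇒recurrent (false ∷ [])        _    = recurrent-take 1 (recurrent-01∷ []-recurrent)
00-free⇒recurrent (false ∷ true ∷ w)  w∌00 = recurrent-01∷ (00-free⇒recurrent w (w∌00 ∘ there ∘ there))
00-free⇒recurrent (false ∷ false ∷ w) w∌00 = ⊥-elim (w∌00 (here (refl ∷ refl ∷ [])))

theorem7 : (w : Word) → (FactorOfB w → ¬ FactorOf zerozero w) × (¬ FactorOf zerozero w → FactorOfB w)
theorem7 w = factor⇒00-free , 00-free⇒factor
  where
  factor⇒00-free : FactorOfB w → ¬ FactorOf zerozero w
  factor⇒00-free (i , occ) = linked⇒00-free (occursAt-linked b b-linked {i = i} occ)

  00-free⇒factor : ¬ FactorOf zerozero w → FactorOfB w
  00-free⇒factor w∌00 with 00-free⇒recurrent w w∌00 0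
  ... | i , _ , occ = i , occ
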